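{- Let $(t_1,\dots,t_m)$ be a non-trivial cycle and let $t_j$ be a smallest term. Then $t_j$ is a node term, i.e., $t_j$ is odd and either $t_{j-1}$ is even, or $t_{j-1}$ is odd and $t_{j-2}$ is even (indices modulo $m$); moreover $t_j\ge 7$.
   Context: The subprime Fibonacci rule: from positive integers $x,y$ with $s=x+y$, the next term is $s$ if $s$ is prime and $s/p$ if $s$ is composite, where $p$ is the smallest prime factor of $s$. A non-trivial cycle of length $m$ is an $m$-tuple $(t_1,\dots,t_m)$ of positive integers, indices read modulo $m$, such that for every $i$, $t_i$ is obtained from $t_{i-2},t_{i-1}$ by this rule, the $t_i$ are not all equal, and $m$ is the minimal period. In such a cycle, the two terms immediately following an even term are odd and are called node terms. -}

module Defs where

open import Data.Nat using (ℕ; zero; suc; _+_; _*_; _≤_; _<_)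
open import Data.Nat.Divisibility using (_∣_)
open import Data.Nat.Primality using (Prime; Composite)
open import Data.Product using (Σ; _×_; ∃)
open import Data.Sum using (_⊎_)
open import Relation.Nullary using (¬_)
open import Relation.Binary.PropositionalEquality using (_≡_; _≢_)

Even : ℕ → Set
Even n = 2 ∣ n

Odd : ℕ → Set
Odd n = ¬ (2 ∣ n)

SmallestPrimeFactor : ℕ → ℕ → Set
SmallestPrimeFactor p s = Prime p × p ∣ s × (∀ q → Prime q → q ∣ s → p ≤ q)

SubprimeStep : ℕ → ℕ → ℕ → Set
SubprimeStep x y z =
  (Prime (x + y) × z ≡ x + y)
  ⊎ (Composite (x + y) × Σ ℕ λ p → SmallestPrimeFactor p (x + y) × z * p ≡ x + y)

-- t : ℕ → ℕ encodes the cycle (t_1,…,t_m) via t i = t_{(i mod m)+1}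
-- (the m-periodic extension; indices read modulo m).
Periodic : ℕ → (ℕ → ℕ) → Set
Periodic m t = ∀ i → t (i + m) ≡ t i

NonTrivialCycle : ℕ → (ℕ → ℕ) → Set
NonTrivialCycle m t =
  1 ≤ m
  × Periodic m t
  × (∀ i → 1 ≤ t i)
  × (∀ i → SubprimeStep (t i) (t (suc i)) (t (suc (suc i))))
  × (Σ ℕ λ i → Σ ℕ λ k → t i ≢ t k)
  × (∀ d → 1 ≤ d → d < m → ¬ Periodic d t)

{-# OPTIONS --safe #-}
-- Let z = t (j + 2) be a least term and x = t j, y = t (j + 1), s = x + y.  If s were prime
-- then z = s > x; so s is composite with least prime factor p and z p = s.  If p = 2 then
-- x + y = 2z with x, y ≥ z forces x = y = z, and the sequence is constant from j on.  Hence
-- s is odd, so z | s is odd and x, y are not both odd.  Finally z ∉ {1, 3, 5}: z = 1 would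
-- make s = p prime, and for a prime z ∈ {3, 5} we get z ≤ y < s ≤ z², leaving finitely many
-- pairs (y , z), each of whose orbits is computed to fall into a cycle that either never
-- contains z again or is constant; both contradict periodicity of a non-trivial cycle.
module Submission where

open import Defs
open import Data.Bool using (Bool; true; false; T; not; _∨_)
open import Data.Bool.Properties using (T-∨; T-not-≡)
open import Data.Nat
open import Data.Nat.Divisibility
open import Data.Nat.DivMod using (_/_; _%_; m/n*n≡m; m%n<n; %-distribˡ-+)
open import Data.Nat.GeneralisedArithmetic using (iterate)
open import Data.Nat.Primality
open import Data.Nat.Properties
open import Data.Product using (Σ; ∃-syntax; _×_; _,_; proj₁; proj₂)
open import Data.Product.Properties using (≡-dec)
open import Data.Sum using (_⊎_; inj₁; inj₂)
open import Function.Base using (_∘_)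
open import Function.Bundles using (Equivalence)
open import Relation.Binary.Definitions using (DecidableEquality)
open import Relation.Binary.PropositionalEquality
open import Relation.Nullary using (¬_; yes; no; contradiction)
open import Relation.Nullary.Decidable using (True; from-yes; toWitness; T?; _→-dec_)

open ≡-Reasoning

prime∧∣∧rough⇒smallest : ∀ {p n} → Prime p → p ∣ n → p Rough n → SmallestPrimeFactor p n
prime∧∣∧rough⇒smallest pp p∣n rough = pp , p∣n , λ q pq q∣n →
  ≮⇒≥ λ q<p → rough (hasNonTrivialDivisor {{prime⇒nonTrivial pq}} q<p q∣n)

-- Trial division by d, d + 1, … ; once d * d > n the d-rough number n is itself prime.
leastPrimeFactorFrom : (fuel d n : ℕ) → ℕ
leastPrimeFactorFrom zero       d n = n
leastPrimeFactorFrom (suc fuel) d n with n <? d * d | d ∣? n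
... | yes _ | _     = n
... | no  _ | yes _ = d
... | no  _ | no  _ = leastPrimeFactorFrom fuel (suc d) n

leastPrimeFactorFrom-smallest : ∀ fuel d n .{{_ : NonTrivial n}} → 2 ≤ d → n ≤ d + fuel →
  d Rough n → SmallestPrimeFactor (leastPrimeFactorFrom fuel d n) n
leastPrimeFactorFrom-smallest zero d n 2≤d n≤d rough =
  prime∧∣∧rough⇒smallest prime[n] ∣-refl (prime⇒rough prime[n])
  where
  prime[n] : Prime n
  prime[n] = prime λ c → rough (hasNonTrivialDivisor-≤ c (subst (n ≤_) (+-identityʳ d) n≤d))
leastPrimeFactorFrom-smallest (suc fuel) d n 2≤d n≤d rough with n <? d * d | d ∣? n
... | yes n<d² | _ = prime∧∣∧rough⇒smallest prime[n] ∣-refl (prime⇒rough prime[n])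
  where
  prime[n] : Prime n
  prime[n] = rough∧square>⇒prime rough n<d²
... | no _ | yes d∣n = prime∧∣∧rough⇒smallest (rough∧∣⇒prime {{n>1⇒nonTrivial 2≤d}} rough d∣n) d∣n rough
... | no _ | no d∤n = leastPrimeFactorFrom-smallest fuel (suc d) n (m≤n⇒m≤1+n 2≤d)
  (subst (n ≤_) (+-suc d fuel) n≤d) (∤⇒rough-suc d∤n rough)

smallestPrimeFactor : ℕ → ℕ
smallestPrimeFactor n = leastPrimeFactorFrom n 2 n

smallestPrimeFactor-spec : ∀ {n} → 2 ≤ n → SmallestPrimeFactor (smallestPrimeFactor n) n
smallestPrimeFactor-spec {n} 2≤n =
  leastPrimeFactorFrom-smallest n 2 n {{n>1⇒nonTrivial 2≤n}} ≤-refl (m≤n+m n 2) 2-rough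

-- The p = 0 clause is junk: p is always a prime.
subprimeRule : ℕ → ℕ → ℕ
subprimeRule s zero        = s
subprimeRule s p@(suc _) with p ≟ s
... | yes _ = s
... | no  _ = s / p

subprimeRule-step : ∀ {x y p} → 1 ≤ x + y → SmallestPrimeFactor p (x + y) →
  SubprimeStep x y (subprimeRule (x + y) p)
subprimeRule-step {p = zero} _ (pp , _) = contradiction pp λ ()
subprimeRule-step {x} {y} {p@(suc _)} 1≤s spf@(pp , p∣s , _) with p ≟ x + y
... | yes p≡s = inj₁ (subst Prime p≡s pp , refl)
... | no  p≢s = inj₂ (composite[s] , p , spf , m/n*n≡m p∣s)
  where
  composite[s] : Composite (x + y)
  composite[s] = hasNonTrivialDivisor {{prime⇒nonTrivial pp}}
    (≤∧≢⇒< (∣⇒≤ {{>-nonZero 1≤s}} p∣s) p≢s) p∣s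

subprimeNext : ℕ → ℕ → ℕ
subprimeNext x y = subprimeRule (x + y) (smallestPrimeFactor (x + y))

subprimeNext-step : ∀ {x y} → 2 ≤ x + y → SubprimeStep x y (subprimeNext x y)
subprimeNext-step {x} {y} 2≤s =
  subprimeRule-step {x} {y} (≤-trans (s≤s z≤n) 2≤s) (smallestPrimeFactor-spec 2≤s)

SubprimeStep-functional : ∀ {x y a b} → SubprimeStep x y a → SubprimeStep x y b → a ≡ b
SubprimeStep-functional (inj₁ (_ , a≡s)) (inj₁ (_ , b≡s)) = trans a≡s (sym b≡s)
SubprimeStep-functional (inj₁ (pr , _))  (inj₂ (c , _))   = contradiction pr (composite⇒¬prime c)
SubprimeStep-functional (inj₂ (c , _))   (inj₁ (pr , _))  = contradiction pr (composite⇒¬prime c)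
SubprimeStep-functional {a = a} {b}
  (inj₂ (_ , p , (pp , p∣s , p-least) , ap≡s)) (inj₂ (_ , q , (qp , q∣s , q-least) , bq≡s))
  with ≤-antisym (p-least q qp q∣s) (q-least p pp p∣s)
... | refl = *-cancelʳ-≡ a b p {{prime⇒nonZero pp}} (trans ap≡s (sym bq≡s))

odd⇒%2≡1 : ∀ {n} → Odd n → n % 2 ≡ 1
odd⇒%2≡1 {n} odd with n % 2 in eq | m%n<n n 2
... | zero        | _             = contradiction (m%n≡0⇒n∣m n 2 eq) odd
... | suc zero    | _             = refl
... | suc (suc _) | s≤s (s≤s ())

odd+odd⇒even : ∀ {m n} → Odd m → Odd n → Even (m + n)
odd+odd⇒even {m} {n} odd-m odd-n = m%n≡0⇒n∣m (m + n) 2 (begin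
  (m + n) % 2             ≡⟨ %-distribˡ-+ m n 2 ⟩
  (m % 2 + n % 2) % 2     ≡⟨ cong₂ (λ a b → (a + b) % 2) (odd⇒%2≡1 odd-m) (odd⇒%2≡1 odd-n) ⟩
  0                       ∎)

odd-summands : ∀ m n → Odd (m + n) → Even n ⊎ (Odd n × Even m)
odd-summands m n odd with 2 ∣? n | 2 ∣? m
... | yes even-n | _          = inj₁ even-n
... | no  odd-n  | yes even-m = inj₂ (odd-n , even-m)
... | no  odd-n  | no  odd-m  = contradiction (odd+odd⇒even odd-m odd-n) odd

odd≥7 : ∀ {n} → Odd n → n ≢ 1 → n ≢ 3 → n ≢ 5 → 7 ≤ n
odd≥7 {0} odd _ _ _ = contradiction (divides 0 refl) odd
odd≥7 {1} _ n≢1 _ _ = contradiction refl n≢1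
odd≥7 {2} odd _ _ _ = contradiction (divides 1 refl) odd
odd≥7 {3} _ _ n≢3 _ = contradiction refl n≢3
odd≥7 {4} odd _ _ _ = contradiction (divides 2 refl) odd
odd≥7 {5} _ _ _ n≢5 = contradiction refl n≢5
odd≥7 {6} odd _ _ _ = contradiction (divides 3 refl) odd
odd≥7 {suc (suc (suc (suc (suc (suc (suc n))))))} _ _ _ _ = m≤m+n 7 n

sum≡double∧≤⇒≡ : ∀ {x y z} → z * 2 ≡ x + y → z ≤ x → z ≤ y → x ≡ z × y ≡ z
sum≡double∧≤⇒≡ {x} {y} {z} 2z≡x+y z≤x z≤y =
    ≤-antisym (+-cancelʳ-≤ z x z (≤-trans (+-monoʳ-≤ x z≤y) x+y≤z+z)) z≤x
  , ≤-antisym (+-cancelˡ-≤ z y z (≤-trans (+-monoˡ-≤ y z≤x) x+y≤z+z)) z≤y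
  where
  x+y≤z+z : x + y ≤ z + z
  x+y≤z+z = ≤-reflexive (trans (sym 2z≡x+y) (trans (*-comm z 2) (cong (z +_) (+-identityʳ z))))

smallestPrimeFactor≢2⇒odd : ∀ {p s} → SmallestPrimeFactor p s → p ≢ 2 → Odd s
smallestPrimeFactor≢2⇒odd (pp , _ , p-least) p≢2 2∣s =
  p≢2 (≤-antisym (p-least 2 prime[2] 2∣s) (nonTrivial⇒n>1 _ {{prime⇒nonTrivial pp}}))

cofactor≤ : ∀ {p s z} → SmallestPrimeFactor p s → Prime z → z * p ≡ s → s ≤ z * z
cofactor≤ {p} {s} {z} (_ , _ , p-least) pz zp≡s =
  subst (_≤ z * z) zp≡s (*-monoʳ-≤ z (p-least z pz (divides p (trans (sym zp≡s) (*-comm z p)))))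

nonincreasing-step⇒composite : ∀ {x y z} → SubprimeStep x y z → 1 ≤ y → z ≤ x →
  Composite (x + y) × Σ ℕ λ p → SmallestPrimeFactor p (x + y) × z * p ≡ x + y
nonincreasing-step⇒composite {x} {y} (inj₁ (_ , z≡s)) 1≤y z≤x =
  contradiction (subst (_≤ x) z≡s z≤x) (<⇒≱ (m<m+n x 1≤y))
nonincreasing-step⇒composite (inj₂ divided) _ _ = divided

module Orbit {A : Set} (_≟_ : DecidableEquality A) (f : A → A) (P : A → Bool) where

  returnsWithin : (fuel : ℕ) (p q : A) → Bool
  returnsWithin zero       p q = false
  returnsWithin (suc fuel) p q with P q | f q ≟ p
  ... | false | _     = false
  ... | true  | yes _ = true
  ... | true  | no  _ = returnsWithin fuel p (f q)

  ReturnsTo : A → A → Set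
  ReturnsTo p q = ∃[ fuel ] T (returnsWithin fuel p q)

  returnsTo-holds : ∀ {p q} → ReturnsTo p q → T (P q)
  returnsTo-holds {p} {q} (suc fuel , h) with P q | f q ≟ p
  ... | true | _ = _

  returnsTo-step : ∀ {p q} → ReturnsTo p p → ReturnsTo p q → ReturnsTo p (f q)
  returnsTo-step {p} {q} p↺ (suc fuel , h) with P q | f q ≟ p
  ... | true | yes fq≡p = subst (ReturnsTo p) (sym fq≡p) p↺
  ... | true | no  _    = fuel , h

  returnsTo-iterate : ∀ {p q} → ReturnsTo p p → ReturnsTo p q → ∀ n → ReturnsTo p (iterate f q n)
  returnsTo-iterate p↺ q↺ zero    = q↺
  returnsTo-iterate p↺ q↺ (suc n) = returnsTo-iterate p↺ (returnsTo-step p↺ q↺) n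

  cycle-invariant : ∀ {fuel p} → T (returnsWithin fuel p p) → ∀ n → T (P (iterate f p n))
  cycle-invariant {fuel} h n = returnsTo-holds (returnsTo-iterate (fuel , h) (fuel , h) n)

iterate-fixedPoint : ∀ {A : Set} (f : A → A) {a} → f a ≡ a → ∀ n → iterate f a n ≡ a
iterate-fixedPoint f fa≡a zero    = refl
iterate-fixedPoint f fa≡a (suc n) rewrite fa≡a = iterate-fixedPoint f fa≡a n

step : ℕ × ℕ → ℕ × ℕ
step (x , y) = y , subprimeNext x y

open Orbit (≡-dec _≟_ _≟_) step using (returnsWithin; cycle-invariant)

escapesAfter : (n fuel : ℕ) → ℕ × ℕ → Bool
escapesAfter n fuel q@(_ , v) = returnsWithin (λ r → not (proj₁ r ≡ᵇ v)) fuel p p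
                              ∨ returnsWithin (λ r → proj₁ r ≡ᵇ proj₁ p) fuel p p
  where
  p : ℕ × ℕ
  p = iterate step q n

-- n and fuel are kept existential: on a symbolic pair, unfolding escapesAfter with numeric n
-- makes the type checker run the orbit symbolically.
Escapes : ℕ × ℕ → Set
Escapes q = ∃[ n ] ∃[ fuel ] T (escapesAfter n fuel q)

escapes-below : ∀ v bound n fuel →
  True (allUpTo? (λ y → v ≤? y →-dec T? (escapesAfter n fuel (y , v))) bound) →
  ∀ {y} → y < bound → v ≤ y → Escapes (y , v)
escapes-below v bound n fuel checked y<bound v≤y = n , fuel , toWitness checked y<bound v≤y

-- The orbits below have transients of at most 105 steps and cycles of length at most 136.
escapes-3 : ∀ {y} → y < 3 * 3 → 3 ≤ y → Escapes (y , 3)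
escapes-3 = escapes-below 3 (3 * 3) 120 150 _

escapes-5 : ∀ {y} → y < 5 * 5 → 5 ≤ y → Escapes (y , 5)
escapes-5 = escapes-below 5 (5 * 5) 120 150 _

module CycleProperties {m : ℕ} {t : ℕ → ℕ} (m≥1 : 1 ≤ m) (periodic : Periodic m t)
  (positive : ∀ i → 1 ≤ t i) (rule : ∀ i → SubprimeStep (t i) (t (suc i)) (t (suc (suc i))))
  (nonconstant : Σ ℕ λ i → Σ ℕ λ k → t i ≢ t k) where

  pairAt : ℕ → ℕ × ℕ
  pairAt i = t i , t (suc i)

  pairAt-suc : ∀ i → pairAt (suc i) ≡ step (pairAt i)
  pairAt-suc i = cong (t (suc i) ,_)
    (SubprimeStep-functional {t i} {t (suc i)} (rule i)
      (subprimeNext-step {t i} {t (suc i)} (+-mono-≤ (positive i) (positive (suc i)))))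

  pairAt-+ : ∀ n i → pairAt (n + i) ≡ iterate step (pairAt i) n
  pairAt-+ zero    i = refl
  pairAt-+ (suc n) i = begin
    pairAt (suc n + i)                ≡⟨ cong pairAt (sym (+-suc n i)) ⟩
    pairAt (n + suc i)                ≡⟨ pairAt-+ n (suc i) ⟩
    iterate step (pairAt (suc i)) n   ≡⟨ cong (λ q → iterate step q n) (pairAt-suc i) ⟩
    iterate step (step (pairAt i)) n  ∎

  periodic-* : ∀ k i → t (i + k * m) ≡ t i
  periodic-* zero    i = cong t (+-identityʳ i)
  periodic-* (suc k) i = begin
    t (i + (m + k * m))  ≡⟨ cong t (trans (cong (i +_) (+-comm m (k * m))) (sym (+-assoc i (k * m) m))) ⟩
    t (i + k * m + m)    ≡⟨ periodic (i + k * m) ⟩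
    t (i + k * m)        ≡⟨ periodic-* k i ⟩
    t i                  ∎

  pairAt-recurs : ∀ i₀ i → ∃[ r ] pairAt i ≡ pairAt (r + i₀)
  pairAt-recurs i₀ i = i + i₀ * m ∸ i₀ , (begin
    pairAt i                         ≡⟨ cong₂ _,_ (periodic-* i₀ i) (periodic-* i₀ (suc i)) ⟨
    pairAt (i + i₀ * m)              ≡⟨ cong pairAt (m∸n+n≡m i₀≤i+i₀m) ⟨
    pairAt (i + i₀ * m ∸ i₀ + i₀)    ∎)
    where
    i₀≤i+i₀m : i₀ ≤ i + i₀ * m
    i₀≤i+i₀m = ≤-trans (m≤m*n i₀ m {{>-nonZero m≥1}}) (m≤n+m (i₀ * m) i)

  everywhere-from : ∀ {ℓ} (Q : ℕ × ℕ → Set ℓ) i₀ → (∀ r → Q (pairAt (r + i₀))) → ∀ i → Q (pairAt i)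
  everywhere-from Q i₀ from-i₀ i with pairAt-recurs i₀ i
  ... | r , eq = subst Q (sym eq) (from-i₀ r)

  not-eventually-constant : ∀ c i₀ → ¬ (∀ r → t (r + i₀) ≡ c)
  not-eventually-constant c i₀ const =
    let i , k , tᵢ≢tₖ = nonconstant in tᵢ≢tₖ (trans (all i) (sym (all k)))
    where
    all : ∀ i → t i ≡ c
    all = everywhere-from (λ q → proj₁ q ≡ c) i₀ const

  invariant-on-limit-cycle : ∀ P fuel i n → let p = iterate step (pairAt i) n in
    T (returnsWithin P fuel p p) → ∀ k → T (P (pairAt k))
  invariant-on-limit-cycle P fuel i n h = everywhere-from (T ∘ P) (n + i) λ r →
    subst (T ∘ P) (sym (trans (pairAt-+ r (n + i)) (cong (λ q → iterate step q r) (pairAt-+ n i))))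
      (cycle-invariant P {fuel} h r)

  ¬escapes : ∀ i → ¬ Escapes (t i , t (suc i))
  ¬escapes i (n , fuel , h) with Equivalence.to T-∨ h
  ... | inj₁ avoids = subst T (Equivalence.to T-not-≡ (invariant-on-limit-cycle _ fuel i n avoids (suc i)))
                        (≡⇒≡ᵇ (t (suc i)) (t (suc i)) refl)
  ... | inj₂ const  = not-eventually-constant _ 0 λ r →
                        ≡ᵇ⇒≡ _ _ (invariant-on-limit-cycle _ fuel i n const (r + 0))

  ¬fixed-pair : ∀ i → step (pairAt i) ≢ pairAt i
  ¬fixed-pair i fixed = not-eventually-constant (t i) i λ r →
    cong proj₁ (trans (pairAt-+ r i) (iterate-fixedPoint step fixed r))

  module LeastTerm (j : ℕ) (minimal : ∀ i → t (suc (suc j)) ≤ t i)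
    (composite[s] : Composite (t j + t (suc j)))
    {p : ℕ} (spf : SmallestPrimeFactor p (t j + t (suc j)))
    (zp≡s : t (suc (suc j)) * p ≡ t j + t (suc j)) where

    -- p = 2 would give t j = t (j + 1) = t (j + 2).
    smallestPrimeFactor≢2 : p ≢ 2
    smallestPrimeFactor≢2 refl = ¬fixed-pair j (begin
      step (pairAt j)    ≡⟨ sym (pairAt-suc j) ⟩
      pairAt (suc j)     ≡⟨ cong₂ _,_ (trans y≡z (sym x≡z)) (sym y≡z) ⟩
      pairAt j           ∎)
      where
      x≡z×y≡z : t j ≡ t (suc (suc j)) × t (suc j) ≡ t (suc (suc j))
      x≡z×y≡z = sum≡double∧≤⇒≡ zp≡s (minimal j) (minimal (suc j))
      x≡z = proj₁ x≡z×y≡z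
      y≡z = proj₂ x≡z×y≡z

    odd-sum : Odd (t j + t (suc j))
    odd-sum = smallestPrimeFactor≢2⇒odd spf smallestPrimeFactor≢2

    odd-least-term : Odd (t (suc (suc j)))
    odd-least-term 2∣z = odd-sum (subst (2 ∣_) zp≡s (∣-trans 2∣z (m∣m*n p)))

    least-term≢1 : t (suc (suc j)) ≢ 1
    least-term≢1 z≡1 = composite⇒¬prime composite[s] (subst Prime p≡s (proj₁ spf))
      where
      p≡s : p ≡ t j + t (suc j)
      p≡s = trans (sym (*-identityˡ p)) (subst (λ w → w * p ≡ t j + t (suc j)) z≡1 zp≡s)

    least-term≢ : ∀ {v} → Prime v → (∀ {y} → y < v * v → v ≤ y → Escapes (y , v)) →
      t (suc (suc j)) ≢ v
    least-term≢ {v} prime[v] escapes z≡v = ¬escapes (suc j) escapes[y,z]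
      where
      v≤y : v ≤ t (suc j)
      v≤y = subst (_≤ t (suc j)) z≡v (minimal (suc j))
      y<v² : t (suc j) < v * v
      y<v² = <-≤-trans (m<n+m (t (suc j)) (positive j))
        (subst (λ w → t j + t (suc j) ≤ w * w) z≡v (cofactor≤ spf (subst Prime (sym z≡v) prime[v]) zp≡s))
      escapes[y,z] : Escapes (t (suc j) , t (suc (suc j)))
      escapes[y,z] = subst (λ w → Escapes (t (suc j) , w)) (sym z≡v) (escapes y<v² v≤y)

lemma15 : (m : ℕ) (t : ℕ → ℕ) → NonTrivialCycle m t →
    (j : ℕ) → (∀ i → t (suc (suc j)) ≤ t i) →
    (Odd (t (suc (suc j)))
      × (Even (t (suc j)) ⊎ (Odd (t (suc j)) × Even (t j))))
    × 7 ≤ t (suc (suc j))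
lemma15 m t (m≥1 , periodic , positive , rule , nonconstant , _) j minimal
  with nonincreasing-step⇒composite (rule j) (positive (suc j)) (minimal j)
... | composite[s] , p , spf , zp≡s =
    (odd-least-term , odd-summands (t j) (t (suc j)) odd-sum)
  , odd≥7 odd-least-term least-term≢1 (least-term≢ prime[3] escapes-3) (least-term≢ prime[5] escapes-5)
  where
  open CycleProperties m≥1 periodic positive rule nonconstant
  open LeastTerm j minimal composite[s] spf zp≡s

  prime[3] : Prime 3
  prime[3] = from-yes (prime? 3)

  prime[5] : Prime 5
  prime[5] = from-yes (prime? 5)
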